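{- For all positive integers $s,t$, $\operatorname{th_{mdim}}(K_{s,t})=s+t$ if $\min(s,t)\le 2$, and $\operatorname{th_{mdim}}(K_{s,t})=s+t-1$ otherwise.
   Context: $K_{s,t}$ is the complete bipartite graph with parts of sizes $s$ and $t$. $\operatorname{dist}(u,v)$ is the shortest-path distance. For an edge $e=\{u,w\}$ and vertex $v$, $\operatorname{dist}(e,v)=\min(\operatorname{dist}(u,v),\operatorname{dist}(w,v))$. For a nonnegative integer $r$ and $a\in V(G)\cup E(G)$, $\operatorname{dist}_r(a,v)=\min(\operatorname{dist}(a,v),r+1)$. A set $S\subseteq V(G)$ is a distance-$r$ mixed resolving set if for all distinct $a,b\in V(G)\cup E(G)$ there is $v\in S$ with $\operatorname{dist}_r(v,a)\ne\operatorname{dist}_r(v,b)$. $\operatorname{mdim}_r(G)$ is the minimum size of such a set and $\operatorname{th_{mdim}}(G)=\min_{r\ge0}(r+\operatorname{mdim}_r(G))$ over nonnegative integers $r$. -}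

module Defs where

open import Data.Nat using (ℕ; zero; suc; _+_; _<ᵇ_; _≤_; _⊓_)
open import Data.Bool using (Bool; true; false; _∧_; _∨_; _xor_; if_then_else_)
open import Data.Fin using (Fin; toℕ; _<_; _≟_)
open import Data.Fin.Subset using (Subset; _∈_; ∣_∣)
open import Data.List using (allFin)
open import Data.Bool.ListAction using (any)
open import Data.Product using (Σ; ∃; _×_; _,_)
open import Relation.Nullary.Decidable using (⌊_⌋)
open import Relation.Binary.PropositionalEquality using (_≡_)

record Graph : Set where
  field
    n     : ℕ
    adj   : Fin n → Fin n → Bool
    sym   : ∀ u v → adj u v ≡ adj v u
    irref : ∀ u → adj u u ≡ false
open Graph public

module _ (G : Graph) where

  reach : ℕ → Fin (n G) → Fin (n G) → Bool
  reach zero u v = ⌊ u ≟ v ⌋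
  reach (suc k) u v = reach k u v ∨ any (λ w → adj G u w ∧ reach k w v) (allFin (n G))

  -- truncated distance between vertices: dist_r(u,v) = min(dist(u,v), r+1)
  distV : ℕ → Fin (n G) → Fin (n G) → ℕ
  distV r u v = go 0 (suc r)
    where
      go : ℕ → ℕ → ℕ
      go i zero = i
      go i (suc m) = if reach i u v then i else go (suc i) m

  -- elements of V(G) ∪ E(G); an edge {u,w} is stored once with u < w
  data Elem : Set where
    vertex : Fin (n G) → Elem
    edge   : (u w : Fin (n G)) → u < w → adj G u w ≡ true → Elem

  distR : ℕ → Fin (n G) → Elem → ℕ
  distR r v (vertex u) = distV r v u
  distR r v (edge u w _ _) = distV r v u ⊓ distV r v w

  IsMixedResolving : ℕ → Subset (n G) → Set
  IsMixedResolving r S =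
    ∀ (a b : Elem) → (∀ v → v ∈ S → distR r v a ≡ distR r v b) → a ≡ b

  IsMdim : ℕ → ℕ → Set
  IsMdim r k =
    (Σ (Subset (n G)) λ S → IsMixedResolving r S × ∣ S ∣ ≡ k)
    × (∀ S → IsMixedResolving r S → k ≤ ∣ S ∣)

  IsThMdim : ℕ → Set
  IsThMdim m =
    (∃ λ r → ∃ λ k → IsMdim r k × r + k ≡ m)
    × (∀ r k → IsMdim r k → m ≤ r + k)

inA : (s t : ℕ) → Fin (s + t) → Bool
inA s t i = toℕ i <ᵇ s

KAdj : (s t : ℕ) → Fin (s + t) → Fin (s + t) → Bool
KAdj s t i j = inA s t i xor inA s t j

KAdj-sym : ∀ s t (i j : Fin (s + t)) → KAdj s t i j ≡ KAdj s t j i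
KAdj-sym s t i j with inA s t i | inA s t j
... | true  | true  = Relation.Binary.PropositionalEquality.refl
... | true  | false = Relation.Binary.PropositionalEquality.refl
... | false | true  = Relation.Binary.PropositionalEquality.refl
... | false | false = Relation.Binary.PropositionalEquality.refl

KAdj-irr : ∀ s t (i : Fin (s + t)) → KAdj s t i i ≡ false
KAdj-irr s t i with inA s t i
... | true  = Relation.Binary.PropositionalEquality.refl
... | false = Relation.Binary.PropositionalEquality.refl

K : ℕ → ℕ → Graph
K s t = record { n = s + t ; adj = KAdj s t ; sym = KAdj-sym s t ; irref = KAdj-irr s t }

{-# OPTIONS --safe #-}

-- For r ≥ 1 the truncated distance in K_{s,t} is the ordinary one: 1 across the two sides and 2
-- between distinct vertices of the same side. At r = 0 a resolving set S contains every vertex x,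
-- for otherwise a neighbour z of x and the edge zx look alike; this gives the value s + t at r = 0.
-- For r ≥ 1 two vertices outside S on the same side are twins, so |S| ≥ s + t − 2, and the set of
-- all vertices but one on each side resolves as soon as each side has at least three vertices,
-- which gives s + t − 1 at r = 1. If some side has at most two vertices, S cannot miss a vertex on
-- both sides: the (at most one) vertex z of S on that side would be confused with the edge from z
-- to the missing vertex on the other side. Then |S| ≥ s + t − 1 for every r ≥ 1, and r = 0 wins.
module Submission where

open import Axiom.UniquenessOfIdentityProofs using (module Decidable⇒UIP)
open import Data.Bool using (Bool; true; false; not; _∧_; _∨_; _xor_; if_then_else_)
open import Data.Bool.ListAction using (any)
open import Data.Bool.Properties
  using (T-≡; ∨-zeroʳ; ∧-identityʳ; ∧-zeroʳ; ¬-not; not-¬; not-injective; xor-same)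
  renaming (_≟_ to _≟ᵇ_)
open import Data.Empty using (⊥; ⊥-elim)
open import Data.Fin using (Fin; zero; suc; toℕ; fromℕ<; _↑ˡ_; _↑ʳ_; _≟_)
  renaming (_<_ to _<ᶠ_; _≤_ to _≤ᶠ_)
import Data.Fin.Properties as Fin
open import Data.Fin.Subset using (Subset; _∈_; _∉_; _⊆_; ∣_∣; ⊤; ∁; _∪_; ⁅_⁆; inside; outside)
open import Data.Fin.Subset.Properties
  using ( _∈?_; ∈⊤; ∣⊤∣≡n; ∣⁅x⁆∣≡1; x∈⁅x⁆; x∈⁅y⁆⇒x≡y; x≢y⇒x∉⁅y⁆; ∣p∣≤∣x∷p∣; ∣∁p∣≡n∸∣p∣
        ; p⊆q⇒∣p∣≤∣q∣; p⊂q⇒∣p∣<∣q∣; p⊆p∪q; q⊆p∪q; x∈p∪q⁺; x∈p∪q⁻; x∈∁p⇒x∉p; x∉∁p⇒x∈p)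
open import Data.List using (List; []; _∷_; allFin)
open import Data.List.Membership.Propositional using (lose)
open import Data.List.Membership.Propositional.Properties using (∈-allFin)
open import Data.List.Relation.Unary.Any.Properties using (any⁺)
open import Data.Nat using (ℕ; zero; suc; _+_; _∸_; _≤_; _<_; _⊓_; z≤n; s≤s)
open import Data.Nat.Properties
  using ( ≤-refl; ≤-reflexive; ≤-trans; ≤-antisym; <-≤-trans; <-trans; <⇒≤; <-irrefl; ≮⇒≥
        ; +-comm; +-suc; +-monoʳ-≤; +-monoˡ-≤; m≤n+m; m≤n+m∸n; m+n∸m≡n; m∸n≤m; m≤n+o⇒m∸n≤o
        ; +-∸-assoc; ∸-monoˡ-<; ∸-cancelʳ-≡; <ᵇ⇒<; <⇒<ᵇ; ⊓-comm; ⊓-zeroʳ; ⊓-sel; m⊓n≤m; m⊓n≤n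
        ; m≤n⇒m⊓n≡m; module ≤-Reasoning)
open import Data.Product using (∃; _×_; _,_; proj₁; proj₂)
open import Data.Sum using (_⊎_; inj₁; inj₂; [_,_]′)
import Data.Sum as Sum
open import Data.Vec using (_∷_; [])
open import Defs hiding (sym)
open import Function using (_∘_; id; Equivalence)
open import Relation.Binary.Definitions using (tri<; tri≈; tri>)
open import Relation.Binary.PropositionalEquality
open import Relation.Nullary using (¬_; yes; no; contradiction)
open import Relation.Nullary.Decidable
  using (dec-true; dec-false; isYes≗does; decidable-stable; toSum; _×-dec_; ¬?)
open import Relation.Unary using (Decidable)

if-true : ∀ {A : Set} {b} {x y : A} → b ≡ true → (if b then x else y) ≡ x
if-true refl = refl

if-false : ∀ {A : Set} {b} {x y : A} → b ≡ false → (if b then x else y) ≡ y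
if-false refl = refl

m⊓n≡0⇒m≡0⊎n≡0 : ∀ {m n} → m ⊓ n ≡ 0 → m ≡ 0 ⊎ n ≡ 0
m⊓n≡0⇒m≡0⊎n≡0 {zero}          _  = inj₁ refl
m⊓n≡0⇒m≡0⊎n≡0 {suc _} {zero}  _  = inj₂ refl
m⊓n≡0⇒m≡0⊎n≡0 {suc _} {suc _} ()

<2-pigeonhole : ∀ {l m n} → l < 2 → m < 2 → n < 2 → m ≢ l → n ≢ l → m ≡ n
<2-pigeonhole {0} {0}     _ _ _ m≢l _   = contradiction refl m≢l
<2-pigeonhole {0} {_} {0} _ _ _ _   n≢l = contradiction refl n≢l
<2-pigeonhole {0} {1} {1} _ _ _ _   _   = refl
<2-pigeonhole {1} {1}     _ _ _ m≢l _   = contradiction refl m≢l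
<2-pigeonhole {1} {_} {1} _ _ _ _   n≢l = contradiction refl n≢l
<2-pigeonhole {1} {0} {0} _ _ _ _   _   = refl
<2-pigeonhole {suc (suc _)}         (s≤s (s≤s ())) _ _ _ _
<2-pigeonhole {_} {suc (suc _)}     _ (s≤s (s≤s ())) _ _ _
<2-pigeonhole {_} {_} {suc (suc _)} _ _ (s≤s (s≤s ())) _ _

≢∧≢⇒≡ : ∀ {x y z : Bool} → x ≢ y → x ≢ z → y ≡ z
≢∧≢⇒≡ x≢y x≢z = not-injective (trans (sym (¬-not x≢y)) (¬-not x≢z))

xor≡true : ∀ {x y} → x ≢ y → x xor y ≡ true
xor≡true {true}  {false} _   = refl
xor≡true {false} {true}  _   = refl
xor≡true {true}  {true}  x≢y = contradiction refl x≢y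
xor≡true {false} {false} x≢y = contradiction refl x≢y

any≡false : ∀ {A : Set} {f : A → Bool} (xs : List A) → (∀ x → f x ≡ false) → any f xs ≡ false
any≡false []       _        = refl
any≡false (x ∷ xs) f≡false rewrite f≡false x = any≡false xs f≡false

-- Finite subsets and counting

∣p∪q∣≤∣p∣+∣q∣ : ∀ {m} (p q : Subset m) → ∣ p ∪ q ∣ ≤ ∣ p ∣ + ∣ q ∣
∣p∪q∣≤∣p∣+∣q∣ []            []            = z≤n
∣p∪q∣≤∣p∣+∣q∣ (inside ∷ p)  (x ∷ q)       =
  s≤s (≤-trans (∣p∪q∣≤∣p∣+∣q∣ p q) (+-monoʳ-≤ ∣ p ∣ (∣p∣≤∣x∷p∣ x q)))
∣p∪q∣≤∣p∣+∣q∣ (outside ∷ p) (inside ∷ q)  =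
  subst (suc ∣ p ∪ q ∣ ≤_) (sym (+-suc ∣ p ∣ ∣ q ∣)) (s≤s (∣p∪q∣≤∣p∣+∣q∣ p q))
∣p∪q∣≤∣p∣+∣q∣ (outside ∷ p) (outside ∷ q) = ∣p∪q∣≤∣p∣+∣q∣ p q

∣⁅x⁆∪⁅y⁆∣≤2 : ∀ {m} (x y : Fin m) → ∣ ⁅ x ⁆ ∪ ⁅ y ⁆ ∣ ≤ 2
∣⁅x⁆∪⁅y⁆∣≤2 x y =
  ≤-trans (∣p∪q∣≤∣p∣+∣q∣ ⁅ x ⁆ ⁅ y ⁆) (≤-reflexive (cong₂ _+_ (∣⁅x⁆∣≡1 x) (∣⁅x⁆∣≡1 y)))

∣⁅x⁆∪⁅y⁆∣≡2 : ∀ {m} {x y : Fin m} → x ≢ y → ∣ ⁅ x ⁆ ∪ ⁅ y ⁆ ∣ ≡ 2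
∣⁅x⁆∪⁅y⁆∣≡2 {x = x} {y} x≢y =
  ≤-antisym (∣⁅x⁆∪⁅y⁆∣≤2 x y) (subst (_< ∣ ⁅ x ⁆ ∪ ⁅ y ⁆ ∣) (∣⁅x⁆∣≡1 x) ⁅x⁆⊂)
  where
  ⁅x⁆⊂ : ∣ ⁅ x ⁆ ∣ < ∣ ⁅ x ⁆ ∪ ⁅ y ⁆ ∣
  ⁅x⁆⊂ = p⊂q⇒∣p∣<∣q∣ (p⊆p∪q ⁅ y ⁆ , y , q⊆p∪q ⁅ x ⁆ ⁅ y ⁆ (x∈⁅x⁆ y) , x≢y⇒x∉⁅y⁆ (x≢y ∘ sym))

∣∁p∣≤k⇒m≤k+∣p∣ : ∀ {m k} {p : Subset m} → ∣ ∁ p ∣ ≤ k → m ≤ k + ∣ p ∣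
∣∁p∣≤k⇒m≤k+∣p∣ {m} {k} {p} ∣∁p∣≤k = begin
  m                    ≤⟨ m≤n+m∸n m ∣ p ∣ ⟩
  ∣ p ∣ + (m ∸ ∣ p ∣)  ≡⟨ +-comm ∣ p ∣ _ ⟩
  m ∸ ∣ p ∣ + ∣ p ∣    ≡⟨ cong (_+ ∣ p ∣) (sym (∣∁p∣≡n∸∣p∣ p)) ⟩
  ∣ ∁ p ∣ + ∣ p ∣      ≤⟨ +-monoˡ-≤ ∣ p ∣ ∣∁p∣≤k ⟩
  k + ∣ p ∣            ∎
  where open ≤-Reasoning

∈∧∉⇒≢ : ∀ {m} {S : Subset m} {v x} → v ∈ S → x ∉ S → v ≢ x
∈∧∉⇒≢ v∈S x∉S refl = x∉S v∈S

AtMostOne : ∀ {m} → (Fin m → Set) → Set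
AtMostOne P = ∀ {x y} → P x → P y → x ≡ y

atMostOne⇒⊆⁅⁆ : ∀ {m} {P : Fin m → Set} → Decidable P → Fin m → AtMostOne P →
                ∃ λ a → ∀ {v} → P v → v ∈ ⁅ a ⁆
atMostOne⇒⊆⁅⁆ P? default unique with Fin.any? P?
... | yes (a , Pa) = a , λ Pv → subst (_∈ ⁅ a ⁆) (sym (unique Pv Pa)) (x∈⁅x⁆ a)
... | no ∄P        = default , λ Pv → contradiction (_ , Pv) ∄P

two-witnesses⇒avoiding : ∀ {m} {P : Fin m → Set} {w₁ w₂} → P w₁ → P w₂ → w₁ ≢ w₂ →
                         ∀ x → ∃ λ w → P w × w ≢ x
two-witnesses⇒avoiding {w₁ = w₁} {w₂} P₁ P₂ w₁≢w₂ x with w₁ ≟ x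
... | yes refl  = w₂ , P₂ , w₁≢w₂ ∘ sym
... | no  w₁≢x = w₁ , P₁ , w₁≢x

endpoint-bounds : ∀ {m} {u w x : Fin m} → u <ᶠ w → x ≡ u ⊎ x ≡ w → u ≤ᶠ x × x ≤ᶠ w
endpoint-bounds u<w (inj₁ refl) = ≤-refl , <⇒≤ u<w
endpoint-bounds u<w (inj₂ refl) = <⇒≤ u<w , ≤-refl

-- Truncated distances in a graph

module _ (G : Graph) where

  vertex-injective : ∀ {x y} → vertex {G} x ≡ vertex y → x ≡ y
  vertex-injective refl = refl

  edge-cong : ∀ {u w u′ w′ u<w uw u′<w′ u′w′} → u ≡ u′ → w ≡ w′ →
              edge {G} u w u<w uw ≡ edge u′ w′ u′<w′ u′w′
  edge-cong refl refl =
    cong₂ (edge _ _) (Fin.<-irrelevant _ _) (Decidable⇒UIP.≡-irrelevant _≟ᵇ_ _ _)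

  adjacent⇒≢ : ∀ {u v} → adj G u v ≡ true → u ≢ v
  adjacent⇒≢ {u} uv refl = contradiction (trans (sym uv) (irref G u)) λ ()

  reach₀-refl : ∀ u → reach G 0 u u ≡ true
  reach₀-refl u = trans (isYes≗does (u ≟ u)) (dec-true (u ≟ u) refl)

  reach₀-≢ : ∀ {u v} → u ≢ v → reach G 0 u v ≡ false
  reach₀-≢ {u} {v} u≢v = trans (isYes≗does (u ≟ v)) (dec-false (u ≟ v) u≢v)

  reach-step : ∀ {k u w v} → adj G u w ≡ true → reach G k w v ≡ true →
               reach G (suc k) u v ≡ true
  reach-step {k} {u} {w} {v} uw wv = trans (cong (reach G k u v ∨_) via-w) (∨-zeroʳ _)
    where
    via-w : any (λ w′ → adj G u w′ ∧ reach G k w′ v) (allFin (n G)) ≡ true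
    via-w = Equivalence.to T-≡
      (any⁺ _ (lose (∈-allFin w) (Equivalence.from T-≡ (cong₂ _∧_ uw wv))))

  reach₁-nonadjacent : ∀ {u v} → u ≢ v → adj G u v ≡ false → reach G 1 u v ≡ false
  reach₁-nonadjacent {u} {v} u≢v uv =
    cong₂ _∨_ (reach₀-≢ u≢v) (any≡false (allFin (n G)) no-step)
    where
    no-step : ∀ w → adj G u w ∧ reach G 0 w v ≡ false
    no-step w with w ≟ v
    ... | yes refl = trans (∧-identityʳ _) uv
    ... | no  _    = ∧-zeroʳ _

  distV-refl : ∀ r u → distV G r u u ≡ 0
  distV-refl r u = if-true (reach₀-refl u)

  distV₀-≢ : ∀ {u v} → u ≢ v → distV G 0 u v ≡ 1
  distV₀-≢ u≢v = if-false (reach₀-≢ u≢v)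

  distV₀-≤1 : ∀ u v → distV G 0 u v ≤ 1
  distV₀-≤1 u v with u ≟ v
  ... | yes _ = z≤n
  ... | no  _ = ≤-refl

  distV₀≡0⇒≡ : ∀ {u v} → distV G 0 u v ≡ 0 → u ≡ v
  distV₀≡0⇒≡ {u} {v} d≡0 with u ≟ v
  ... | yes u≡v = u≡v
  ... | no  _   = contradiction d≡0 λ ()

  distV-adjacent : ∀ r {u v} → adj G u v ≡ true → distV G (suc r) u v ≡ 1
  distV-adjacent r {u} {v} uv =
    trans (if-false (reach₀-≢ (adjacent⇒≢ uv))) (if-true (reach-step {0} uv (reach₀-refl v)))

  distV-common-neighbour : ∀ r {u w v} → u ≢ v → adj G u v ≡ false →
                           adj G u w ≡ true → adj G w v ≡ true → distV G (suc r) u v ≡ 2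
  distV-common-neighbour zero u≢v uv _ _ =
    trans (if-false (reach₀-≢ u≢v)) (if-false (reach₁-nonadjacent u≢v uv))
  distV-common-neighbour (suc r) {v = v} u≢v uv uw wv =
    trans (if-false (reach₀-≢ u≢v)) (trans (if-false (reach₁-nonadjacent u≢v uv))
      (if-true (reach-step {1} uw (reach-step {0} wv (reach₀-refl v)))))

  edgeOf : ∀ u w → adj G u w ≡ true → Elem G
  edgeOf u w uw with Fin.<-cmp u w
  ... | tri< u<w _ _ = edge u w u<w uw
  ... | tri≈ _ u≡w _ = contradiction u≡w (adjacent⇒≢ uw)
  ... | tri> _ _ w<u = edge w u w<u (trans (Graph.sym G w u) uw)

  distR-edgeOf : ∀ r v u w (uw : adj G u w ≡ true) →
                 distR G r v (edgeOf u w uw) ≡ distV G r v u ⊓ distV G r v w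
  distR-edgeOf r v u w uw with Fin.<-cmp u w
  ... | tri< _ _ _   = refl
  ... | tri≈ _ u≡w _ = contradiction u≡w (adjacent⇒≢ uw)
  ... | tri> _ _ _   = ⊓-comm _ _

  vertex≢edgeOf : ∀ x u w (uw : adj G u w ≡ true) → vertex x ≢ edgeOf u w uw
  vertex≢edgeOf x u w uw with Fin.<-cmp u w
  ... | tri< _ _ _   = λ ()
  ... | tri≈ _ u≡w _ = contradiction u≡w (adjacent⇒≢ uw)
  ... | tri> _ _ _   = λ ()

  edge-distˡ≡0 : ∀ r {u w} → distV G r u u ⊓ distV G r u w ≡ 0
  edge-distˡ≡0 r {u} {w} = cong (_⊓ distV G r u w) (distV-refl r u)

  edge-distʳ≡0 : ∀ r {u w} → distV G r w u ⊓ distV G r w w ≡ 0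
  edge-distʳ≡0 r {u} {w} = trans (cong (distV G r w u ⊓_) (distV-refl r w)) (⊓-zeroʳ _)

  edge-dist₀≡0⇒endpoint : ∀ {v u w} → distV G 0 v u ⊓ distV G 0 v w ≡ 0 → v ≡ u ⊎ v ≡ w
  edge-dist₀≡0⇒endpoint = Sum.map distV₀≡0⇒≡ distV₀≡0⇒≡ ∘ m⊓n≡0⇒m≡0⊎n≡0

  vertex≢edge₀ : ∀ {x u w} → u <ᶠ w →
                 ¬ (∀ v → v ∈ ⊤ → distV G 0 v x ≡ distV G 0 v u ⊓ distV G 0 v w)
  vertex≢edge₀ {x} {u} {w} u<w same =
    Fin.<⇒≢ u<w (trans (touches (edge-distˡ≡0 0)) (sym (touches (edge-distʳ≡0 0))))
    where
    touches : ∀ {v} → distV G 0 v u ⊓ distV G 0 v w ≡ 0 → v ≡ x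
    touches {v} d≡0 = distV₀≡0⇒≡ (trans (same v ∈⊤) d≡0)

  -- Each edge has the endpoints of the other one among its endpoints, and the endpoints of an edge
  -- u < w lie between u and w; so the two ordered pairs coincide.
  ⊤-resolving₀ : IsMixedResolving G 0 ⊤
  ⊤-resolving₀ (vertex x) (vertex y) same =
    cong vertex (distV₀≡0⇒≡ (trans (sym (same x ∈⊤)) (distV-refl 0 x)))
  ⊤-resolving₀ (vertex _) (edge _ _ u<w _) same = contradiction same (vertex≢edge₀ u<w)
  ⊤-resolving₀ (edge _ _ u<w _) (vertex _) same =
    contradiction (λ v v∈ → sym (same v v∈)) (vertex≢edge₀ u<w)
  ⊤-resolving₀ (edge u w u<w _) (edge u′ w′ u′<w′ _) same =
    edge-cong (Fin.≤-antisym (proj₁ (endpoint-bounds u<w (in-e (edge-distˡ≡0 0))))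
                             (proj₁ (endpoint-bounds u′<w′ (in-e′ (edge-distˡ≡0 0)))))
              (Fin.≤-antisym (proj₂ (endpoint-bounds u′<w′ (in-e′ (edge-distʳ≡0 0))))
                             (proj₂ (endpoint-bounds u<w (in-e (edge-distʳ≡0 0)))))
    where
    in-e : ∀ {v} → distV G 0 v u′ ⊓ distV G 0 v w′ ≡ 0 → v ≡ u ⊎ v ≡ w
    in-e {v} d≡0 = edge-dist₀≡0⇒endpoint (trans (same v ∈⊤) d≡0)
    in-e′ : ∀ {v} → distV G 0 v u ⊓ distV G 0 v w ≡ 0 → v ≡ u′ ⊎ v ≡ w′
    in-e′ {v} d≡0 = edge-dist₀≡0⇒endpoint (trans (sym (same v ∈⊤)) d≡0)

  -- If x ∉ S, then dist₀(v, x) = 1 for every v ∈ S, so v cannot tell the vertex z from the edge zx.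
  resolving₀-∋ : ∀ {S z x} → IsMixedResolving G 0 S → adj G z x ≡ true → x ∈ S
  resolving₀-∋ {S} {z} {x} resolving zx with x ∈? S
  ... | yes x∈S = x∈S
  ... | no  x∉S =
    contradiction (resolving (vertex z) (edgeOf z x zx) same) (vertex≢edgeOf z z x zx)
    where
    same : ∀ v → v ∈ S → distV G 0 v z ≡ distR G 0 v (edgeOf z x zx)
    same v v∈S = begin
      distV G 0 v z                  ≡⟨ sym (m≤n⇒m⊓n≡m (≤-trans (distV₀-≤1 v z) (≤-reflexive d₁))) ⟩
      distV G 0 v z ⊓ distV G 0 v x  ≡⟨ sym (distR-edgeOf 0 v z x zx) ⟩
      distR G 0 v (edgeOf z x zx)    ∎
      where
      open ≡-Reasoning
      d₁ : 1 ≡ distV G 0 v x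
      d₁ = sym (distV₀-≢ (∈∧∉⇒≢ v∈S x∉S))

  mdim₀ : (∀ x → ∃ λ z → adj G z x ≡ true) → IsMdim G 0 (n G)
  mdim₀ neighbour = (⊤ , ⊤-resolving₀ , ∣⊤∣≡n (n G)) , λ S resolving →
    subst (_≤ ∣ S ∣) (∣⊤∣≡n (n G))
      (p⊆q⇒∣p∣≤∣q∣ {p = ⊤} (λ {x} _ → resolving₀-∋ resolving (proj₂ (neighbour x))))

  isThMdim : ∀ {r k m} → IsMdim G r k → r + k ≡ m →
             (∀ r S → IsMixedResolving G r S → m ≤ r + ∣ S ∣) → IsThMdim G m
  isThMdim {r} {k} mdim r+k≡m bound =
    (r , k , mdim , r+k≡m) , λ { r′ k′ ((S , resolving , ∣S∣≡k′) , _) →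
      subst (λ j → _ ≤ r′ + j) ∣S∣≡k′ (bound r′ S resolving) }

-- The complete bipartite graph

inA-↑ˡ : ∀ {s} t (i : Fin s) → inA s t (i ↑ˡ t) ≡ true
inA-↑ˡ {suc _} t zero    = refl
inA-↑ˡ {suc s} t (suc i) = inA-↑ˡ {s} t i

inA-↑ʳ : ∀ s {t} (j : Fin t) → inA s t (s ↑ʳ j) ≡ false
inA-↑ʳ zero    j = refl
inA-↑ʳ (suc s) j = inA-↑ʳ s j

module CompleteBipartite (s′ t′ : ℕ) where

  s t : ℕ
  s = suc s′
  t = suc t′

  G : Graph
  G = K s t

  V : Set
  V = Fin (s + t)

  sideSize : Bool → ℕ
  sideSize true  = s
  sideSize false = t

  sideVertex : ∀ p → Fin (sideSize p) → V
  sideVertex true  i = i ↑ˡ t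
  sideVertex false j = s ↑ʳ j

  sideVertex-injective : ∀ p {i j} → sideVertex p i ≡ sideVertex p j → i ≡ j
  sideVertex-injective true  = Fin.↑ˡ-injective t _ _
  sideVertex-injective false = Fin.↑ʳ-injective s _ _

  origin : ∀ p → Fin (sideSize p)
  origin true  = zero
  origin false = zero

  basepoint : Bool → V
  basepoint p = sideVertex p (origin p)

  -- Opaque, so that an equation about side v determines v when implicit arguments are inferred.
  opaque
    side : V → Bool
    side = inA s t

    side-sideVertex : ∀ p i → side (sideVertex p i) ≡ p
    side-sideVertex true  = inA-↑ˡ t
    side-sideVertex false = inA-↑ʳ s

    side⇒< : ∀ {v} → side v ≡ true → toℕ v < s
    side⇒< {v} v∈A = <ᵇ⇒< (toℕ v) s (Equivalence.from T-≡ v∈A)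

    side⇒≥ : ∀ {v} → side v ≡ false → s ≤ toℕ v
    side⇒≥ v∈B = ≮⇒≥ λ v<s →
      contradiction (trans (sym (Equivalence.to T-≡ (<⇒<ᵇ v<s))) v∈B) λ ()

    adj-same : ∀ {u v} → side u ≡ side v → KAdj s t u v ≡ false
    adj-same {u} same = trans (cong (side u xor_) (sym same)) (xor-same (side u))

    adj-cross : ∀ {u v} → side u ≢ side v → KAdj s t u v ≡ true
    adj-cross {u} {v} = xor≡true {side u} {side v}

  side-basepoint : ∀ p → side (basepoint p) ≡ p
  side-basepoint p = side-sideVertex p (origin p)

  opposite-sides : ∀ {u v} → side u ≡ true → side v ≡ false → side u ≢ side v
  opposite-sides u∈A v∈B same = contradiction (trans (sym u∈A) (trans same v∈B)) λ ()

  sideIndex : Bool → V → ℕ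
  sideIndex true  v = toℕ v
  sideIndex false v = toℕ v ∸ s

  sideIndex<sideSize : ∀ {p v} → side v ≡ p → sideIndex p v < sideSize p
  sideIndex<sideSize {true}  v∈A = side⇒< v∈A
  sideIndex<sideSize {false} {v} v∈B =
    subst (toℕ v ∸ s <_) (m+n∸m≡n s t) (∸-monoˡ-< (Fin.toℕ<n v) (side⇒≥ v∈B))

  sideIndex-injective : ∀ {p v w} → side v ≡ p → side w ≡ p →
                        sideIndex p v ≡ sideIndex p w → v ≡ w
  sideIndex-injective {true}  _   _   = Fin.toℕ-injective
  sideIndex-injective {false} v∈B w∈B =
    Fin.toℕ-injective ∘ ∸-cancelʳ-≡ (side⇒≥ v∈B) (side⇒≥ w∈B)

  side-pigeonhole : ∀ {p x v w} → sideSize p ≤ 2 → side x ≡ p → side v ≡ p → side w ≡ p →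
                    v ≢ x → w ≢ x → v ≡ w
  side-pigeonhole {p} small x~p v~p w~p v≢x w≢x =
    sideIndex-injective v~p w~p
      (<2-pigeonhole (bounded x~p) (bounded v~p) (bounded w~p)
        (v≢x ∘ sideIndex-injective v~p x~p) (w≢x ∘ sideIndex-injective w~p x~p))
    where
    bounded : ∀ {u} → side u ≡ p → sideIndex p u < 2
    bounded u~p = <-≤-trans (sideIndex<sideSize u~p) small

  edge-sides : ∀ {u w} → u <ᶠ w → KAdj s t u w ≡ true → side u ≡ true × side w ≡ false
  edge-sides {u} {w} u<w uw = ¬-not u∉B , trans (¬-not (differ ∘ sym)) (cong not (¬-not u∉B))
    where
    differ : side u ≢ side w
    differ same = contradiction (trans (sym uw) (adj-same same)) λ ()
    u∉B : side u ≢ false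
    u∉B u∈B = <-irrefl refl (<-≤-trans (<-trans u<w (side⇒< w∈A)) (side⇒≥ u∈B))
      where
      w∈A : side w ≡ true
      w∈A = trans (¬-not (differ ∘ sym)) (cong not u∈B)

  neighbour : ∀ x → ∃ λ z → KAdj s t z x ≡ true
  neighbour x = basepoint (not (side x)) , adj-cross
    (λ e → not-¬ refl (trans (sym e) (side-basepoint (not (side x)))))

  dist-cross : ∀ r {u v} → side u ≢ side v → distV G (suc r) u v ≡ 1
  dist-cross r {u} {v} differ = distV-adjacent G r {u} {v} (adj-cross differ)

  dist-same : ∀ r {u v} → u ≢ v → side u ≡ side v → distV G (suc r) u v ≡ 2
  dist-same r {u} {v} u≢v same =
    distV-common-neighbour G r {u} {o} {v} u≢v
      (adj-same same) (adj-cross u≁o) (adj-cross o≁v)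
    where
    o : V
    o = basepoint (not (side u))
    u≁o : side u ≢ side o
    u≁o e = not-¬ refl (trans e (side-basepoint (not (side u))))
    o≁v : side o ≢ side v
    o≁v e = u≁o (trans same (sym e))

  dist-≢⇒≢0 : ∀ r {u v} → u ≢ v → distV G (suc r) u v ≢ 0
  dist-≢⇒≢0 r {u} {v} u≢v with side u ≟ᵇ side v
  ... | yes same  = λ d≡0 → contradiction (trans (sym (dist-same r u≢v same)) d≡0) λ ()
  ... | no differ = λ d≡0 → contradiction (trans (sym (dist-cross r differ)) d≡0) λ ()

  dist≡0⇒≡ : ∀ r {u v} → distV G (suc r) u v ≡ 0 → u ≡ v
  dist≡0⇒≡ r {u} {v} d≡0 = decidable-stable (u ≟ v) λ u≢v → dist-≢⇒≢0 r u≢v d≡0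

  dist-twins : ∀ r {v x y} → v ≢ x → v ≢ y → side x ≡ side y →
               distV G (suc r) v x ≡ distV G (suc r) v y
  dist-twins r {v} {x} {y} v≢x v≢y x~y with side v ≟ᵇ side x
  ... | yes v~x = trans (dist-same r v≢x v~x) (sym (dist-same r v≢y (trans v~x x~y)))
  ... | no  v≁x =
    trans (dist-cross r v≁x) (sym (dist-cross r (v≁x ∘ λ v~y → trans v~y (sym x~y))))

  edge-dist≡0⇒endpoint : ∀ r {v u w} → distV G (suc r) v u ⊓ distV G (suc r) v w ≡ 0 →
                         v ≡ u ⊎ v ≡ w
  edge-dist≡0⇒endpoint r = Sum.map (dist≡0⇒≡ r) (dist≡0⇒≡ r) ∘ m⊓n≡0⇒m≡0⊎n≡0

  edge-dist≤1 : ∀ r v {u w} → side u ≡ true → side w ≡ false →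
                distV G (suc r) v u ⊓ distV G (suc r) v w ≤ 1
  edge-dist≤1 r v {u} {w} u∈A w∈B with side v ≟ᵇ true
  ... | yes v∈A = ≤-trans (m⊓n≤n _ _) (≤-reflexive (dist-cross r (opposite-sides v∈A w∈B)))
  ... | no  v∉A =
    ≤-trans (m⊓n≤m _ _) (≤-reflexive (dist-cross r (v∉A ∘ λ v~u → trans v~u u∈A)))

  OneOutsidePerSide : Subset (s + t) → Set
  OneOutsidePerSide S = ∀ {x y} → x ∉ S → y ∉ S → side x ≡ side y → x ≡ y

  resolving⇒oneOutsidePerSide : ∀ r {S} → IsMixedResolving G (suc r) S → OneOutsidePerSide S
  resolving⇒oneOutsidePerSide r resolving {x} {y} x∉S y∉S x~y =
    vertex-injective G (resolving (vertex x) (vertex y) λ v v∈S →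
      dist-twins r (∈∧∉⇒≢ v∈S x∉S) (∈∧∉⇒≢ v∈S y∉S) x~y)

  oneOutsidePerSide⇒≤2+ : ∀ {S} → OneOutsidePerSide S → s + t ≤ 2 + ∣ S ∣
  oneOutsidePerSide⇒≤2+ {S} one =
    ∣∁p∣≤k⇒m≤k+∣p∣ {p = S} (≤-trans (p⊆q⇒∣p∣≤∣q∣ ∁S⊆) (∣⁅x⁆∪⁅y⁆∣≤2 a b))
    where
    outsideOn : ∀ p → ∃ λ a → ∀ {v} → v ∉ S × side v ≡ p → v ∈ ⁅ a ⁆
    outsideOn p = atMostOne⇒⊆⁅⁆ (λ v → ¬? (v ∈? S) ×-dec (side v ≟ᵇ p)) (basepoint p)
      λ (x∉S , x~p) (y∉S , y~p) → one x∉S y∉S (trans x~p (sym y~p))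
    a b : V
    a = proj₁ (outsideOn true)
    b = proj₁ (outsideOn false)
    ∁S⊆ : ∁ S ⊆ ⁅ a ⁆ ∪ ⁅ b ⁆
    ∁S⊆ {v} v∈∁S with side v ≟ᵇ true
    ... | yes v∈A = x∈p∪q⁺ (inj₁ (proj₂ (outsideOn true)  (x∈∁p⇒x∉p v∈∁S , v∈A)))
    ... | no  v∉A = x∈p∪q⁺ (inj₂ (proj₂ (outsideOn false) (x∈∁p⇒x∉p v∈∁S , ¬-not v∉A)))

  resolving⇒≤2+ : ∀ r {S} → IsMixedResolving G (suc r) S → s + t ≤ 2 + ∣ S ∣
  resolving⇒≤2+ r = oneOutsidePerSide⇒≤2+ ∘ resolving⇒oneOutsidePerSide r

  loneOnSide : ∀ {p S x} → sideSize p ≤ 2 → x ∉ S → side x ≡ p →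
               ∃ λ z → side z ≡ p × (∀ {v} → v ∈ S → side v ≡ p → v ≡ z)
  loneOnSide {p} {S} {x} small x∉S x~p with Fin.any? (λ v → v ∈? S ×-dec side v ≟ᵇ p)
  ... | yes (w , w∈S , w~p) = w , w~p , λ v∈S v~p →
          side-pigeonhole small x~p v~p w~p (∈∧∉⇒≢ v∈S x∉S) (∈∧∉⇒≢ w∈S x∉S)
  ... | no  ∄w              = x , x~p , λ v∈S v~p → contradiction (_ , v∈S , v~p) ∄w

  -- Every v ∈ S other than z lies on the side of y, at distance 1 from z and 2 from y.
  lone-vertex-unresolved : ∀ r {S z y} → side z ≢ side y → y ∉ S →
                           (∀ {v} → v ∈ S → side v ≡ side z → v ≡ z) →
                           ¬ IsMixedResolving G (suc r) S
  lone-vertex-unresolved r {S} {z} {y} z≁y y∉S lone resolving =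
    vertex≢edgeOf G z z y zy (resolving (vertex z) (edgeOf G z y zy) same)
    where
    zy : KAdj s t z y ≡ true
    zy = adj-cross z≁y
    at-z : distV G (suc r) z z ≡ distR G (suc r) z (edgeOf G z y zy)
    at-z = trans (distV-refl G (suc r) z)
                 (sym (trans (distR-edgeOf G (suc r) z z y zy) (edge-distˡ≡0 G (suc r) {z} {y})))
    off-z : ∀ {v} → v ∈ S → v ≢ z → distV G (suc r) v z ≡ distR G (suc r) v (edgeOf G z y zy)
    off-z {v} v∈S v≢z = begin
      distV G (suc r) v z                        ≡⟨ dist-cross r v≁z ⟩
      1 ⊓ 2                                      ≡⟨ sym (cong₂ _⊓_ (dist-cross r v≁z) d₂) ⟩
      distV G (suc r) v z ⊓ distV G (suc r) v y  ≡⟨ sym (distR-edgeOf G (suc r) v z y zy) ⟩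
      distR G (suc r) v (edgeOf G z y zy)        ∎
      where
      open ≡-Reasoning
      v≁z : side v ≢ side z
      v≁z = v≢z ∘ lone v∈S
      d₂ : distV G (suc r) v y ≡ 2
      d₂ = dist-same r (∈∧∉⇒≢ v∈S y∉S) (≢∧≢⇒≡ (v≁z ∘ sym) z≁y)
    same : ∀ v → v ∈ S → distV G (suc r) v z ≡ distR G (suc r) v (edgeOf G z y zy)
    same v v∈S = [ (λ { refl → at-z }) , off-z v∈S ]′ (toSum (v ≟ z))

  small-side⇒≤1+ : ∀ r {p S} → sideSize p ≤ 2 → IsMixedResolving G (suc r) S →
                   s + t ≤ 1 + ∣ S ∣
  small-side⇒≤1+ r {p} {S} small resolving =
    ∣∁p∣≤k⇒m≤k+∣p∣ {p = S}
      (≤-trans (p⊆q⇒∣p∣≤∣q∣ (proj₂ representative ∘ x∈∁p⇒x∉p))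
               (≤-reflexive (∣⁅x⁆∣≡1 (proj₁ representative))))
    where
    no-cross : ∀ {x y} → x ∉ S → y ∉ S → side x ≡ p → side y ≢ p → ⊥
    no-cross x∉S y∉S x~p y≁p with loneOnSide small x∉S x~p
    ... | z , z~p , lone =
      lone-vertex-unresolved r (λ e → y≁p (trans (sym e) z~p)) y∉S
        (λ v∈S v~z → lone v∈S (trans v~z z~p)) resolving
    one-outside : AtMostOne (_∉ S)
    one-outside {x} {y} x∉S y∉S with side x ≟ᵇ side y | side x ≟ᵇ p
    ... | yes x~y | _       = resolving⇒oneOutsidePerSide r resolving x∉S y∉S x~y
    ... | no  x≁y | yes x~p = ⊥-elim (no-cross x∉S y∉S x~p λ y~p → x≁y (trans x~p (sym y~p)))
    ... | no  x≁y | no  x≁p = ⊥-elim (no-cross y∉S x∉S (sym (≢∧≢⇒≡ x≁p x≁y)) x≁p)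
    representative : ∃ λ a → ∀ {v} → v ∉ S → v ∈ ⁅ a ⁆
    representative = atMostOne⇒⊆⁅⁆ (λ v → ¬? (v ∈? S)) (basepoint true) one-outside

  TwoOnEachSide : Subset (s + t) → Set
  TwoOnEachSide S = ∀ p x → ∃ λ w → (w ∈ S × side w ≡ p) × w ≢ x

  vertices-resolved : ∀ r {S x y} → OneOutsidePerSide S → TwoOnEachSide S →
                      (∀ v → v ∈ S → distV G (suc r) v x ≡ distV G (suc r) v y) → x ≡ y
  vertices-resolved r {S} {x} {y} one two same with x ∈? S | y ∈? S | side x ≟ᵇ side y
  ... | yes x∈S | _       | _       =
    dist≡0⇒≡ r (trans (sym (same x x∈S)) (distV-refl G (suc r) x))
  ... | no  _   | yes y∈S | _       =
    sym (dist≡0⇒≡ r (trans (same y y∈S) (distV-refl G (suc r) y)))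
  ... | no  x∉S | no  y∉S | yes x~y = one x∉S y∉S x~y
  ... | no  _   | no  _   | no  x≁y with two (side x) x
  ...   | w , (w∈S , w~x) , w≢x =
    contradiction (trans (sym (dist-same r w≢x w~x)) (trans (same w w∈S) (dist-cross r w≁y))) λ ()
    where
    w≁y : side w ≢ side y
    w≁y w~y = x≁y (trans (sym w~x) w~y)

  vertex-edge-separated : ∀ r {S x u w} → TwoOnEachSide S → side u ≡ true → side w ≡ false →
    ¬ (∀ v → v ∈ S → distV G (suc r) v x ≡ distV G (suc r) v u ⊓ distV G (suc r) v w)
  vertex-edge-separated r {x = x} two u∈A w∈B same with two (side x) x
  ... | v , (v∈S , v~x) , v≢x =
    contradiction (subst (_≤ 1) (trans (sym (same v v∈S)) (dist-same r v≢x v~x))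
                         (edge-dist≤1 r v u∈A w∈B))
      λ { (s≤s ()) }

  endpoint-determined : ∀ r {S u w u′ w′} → OneOutsidePerSide S →
    side u ≡ side u′ → side u ≢ side w′ → side u′ ≢ side w →
    (∀ v → v ∈ S → distV G (suc r) v u  ⊓ distV G (suc r) v w
                 ≡ distV G (suc r) v u′ ⊓ distV G (suc r) v w′) →
    u ≡ u′
  endpoint-determined r {S} {u} {w} {u′} {w′} one u~u′ u≁w′ u′≁w same with u ∈? S | u′ ∈? S
  ... | yes u∈S | _ =
    [ id , (λ u≡w′ → contradiction (cong side u≡w′) u≁w′) ]′
      (edge-dist≡0⇒endpoint r (trans (sym (same u u∈S)) (edge-distˡ≡0 G (suc r) {u} {w})))
  ... | no _ | yes u′∈S =
    [ sym , (λ u′≡w → contradiction (cong side u′≡w) u′≁w) ]′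
      (edge-dist≡0⇒endpoint r (trans (same u′ u′∈S) (edge-distˡ≡0 G (suc r) {u′} {w′})))
  ... | no u∉S | no u′∉S = one u∉S u′∉S u~u′

  oneOutside∧twoInside⇒resolving : ∀ r {S} → OneOutsidePerSide S → TwoOnEachSide S →
                                   IsMixedResolving G (suc r) S
  oneOutside∧twoInside⇒resolving r one two (vertex x) (vertex y) same =
    cong vertex (vertices-resolved r one two same)
  oneOutside∧twoInside⇒resolving r one two (vertex x) (edge u w u<w uw) same
    with edge-sides u<w uw
  ... | u∈A , w∈B = contradiction same (vertex-edge-separated r two u∈A w∈B)
  oneOutside∧twoInside⇒resolving r one two (edge u w u<w uw) (vertex x) same
    with edge-sides u<w uw
  ... | u∈A , w∈B =
    contradiction (λ v v∈S → sym (same v v∈S)) (vertex-edge-separated r two u∈A w∈B)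
  oneOutside∧twoInside⇒resolving r one two (edge u w u<w uw) (edge u′ w′ u′<w′ u′w′) same
    with edge-sides u<w uw | edge-sides u′<w′ u′w′
  ... | u∈A , w∈B | u′∈A , w′∈B =
    edge-cong G
      (endpoint-determined r one (trans u∈A (sym u′∈A))
        (opposite-sides u∈A w′∈B) (opposite-sides u′∈A w∈B) same)
      (endpoint-determined r one (trans w∈B (sym w′∈B))
        (opposite-sides u′∈A w∈B ∘ sym) (opposite-sides u∈A w′∈B ∘ sym)
        λ v v∈S → trans (⊓-comm _ _) (trans (same v v∈S) (⊓-comm _ _)))

  S₀ : Subset (s + t)
  S₀ = ∁ (⁅ basepoint true ⁆ ∪ ⁅ basepoint false ⁆)

  ∣S₀∣ : ∣ S₀ ∣ ≡ s + t ∸ 2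
  ∣S₀∣ = trans (∣∁p∣≡n∸∣p∣ (⁅ basepoint true ⁆ ∪ ⁅ basepoint false ⁆))
               (cong (s + t ∸_) (∣⁅x⁆∪⁅y⁆∣≡2 basepoints-differ))
    where
    basepoints-differ : basepoint true ≢ basepoint false
    basepoints-differ e = opposite-sides (side-basepoint true) (side-basepoint false) (cong side e)

  ∉S₀⇒basepoint : ∀ {x} → x ∉ S₀ → x ≡ basepoint (side x)
  ∉S₀⇒basepoint x∉S₀ = [ at {true} , at {false} ]′ (x∈p∪q⁻ _ _ (x∉∁p⇒x∈p x∉S₀))
    where
    at : ∀ {p x} → x ∈ ⁅ basepoint p ⁆ → x ≡ basepoint (side x)
    at {p} {x} x∈ = trans x≡ (cong basepoint (sym (trans (cong side x≡) (side-basepoint p))))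
      where
      x≡ : x ≡ basepoint p
      x≡ = x∈⁅y⁆⇒x≡y _ x∈

  oneOutsidePerSide-S₀ : OneOutsidePerSide S₀
  oneOutsidePerSide-S₀ x∉S₀ y∉S₀ x~y =
    trans (∉S₀⇒basepoint x∉S₀) (trans (cong basepoint x~y) (sym (∉S₀⇒basepoint y∉S₀)))

  toℕ-origin : ∀ p → toℕ (origin p) ≡ 0
  toℕ-origin true  = refl
  toℕ-origin false = refl

  sideVertex-∈S₀ : ∀ p {i} → toℕ i ≢ 0 → sideVertex p i ∈ S₀
  sideVertex-∈S₀ p {i} i≢0 with sideVertex p i ∈? S₀
  ... | yes ∈S₀ = ∈S₀
  ... | no  ∉S₀ = contradiction (trans (cong toℕ i≡origin) (toℕ-origin p)) i≢0
    where
    i≡origin : i ≡ origin p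
    i≡origin = sideVertex-injective p
      (trans (∉S₀⇒basepoint ∉S₀) (cong basepoint (side-sideVertex p i)))

  twoOnEachSide-S₀ : (∀ p → 3 ≤ sideSize p) → TwoOnEachSide S₀
  twoOnEachSide-S₀ large p =
    two-witnesses⇒avoiding (at-∈S₀ 1<size , side-sideVertex p _)
                           (at-∈S₀ (large p) , side-sideVertex p _) distinct
    where
    1<size : 1 < sideSize p
    1<size = ≤-trans (s≤s (s≤s z≤n)) (large p)
    position : ∀ {k} (k<size : k < sideSize p) → toℕ (fromℕ< k<size) ≡ k
    position k<size = Fin.toℕ-fromℕ< k<size
    at-∈S₀ : ∀ {k} (k<size : suc k < sideSize p) → sideVertex p (fromℕ< k<size) ∈ S₀
    at-∈S₀ k<size = sideVertex-∈S₀ p λ e → contradiction (trans (sym (position k<size)) e) λ ()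
    distinct : sideVertex p (fromℕ< 1<size) ≢ sideVertex p (fromℕ< (large p))
    distinct e = contradiction 1≡2 λ ()
      where
      1≡2 : 1 ≡ 2
      1≡2 = trans (sym (position 1<size))
                  (trans (cong toℕ (sideVertex-injective p e)) (position (large p)))

  mdim₁-large : (∀ p → 3 ≤ sideSize p) → IsMdim G 1 (s + t ∸ 2)
  mdim₁-large large =
    (S₀ , oneOutside∧twoInside⇒resolving 0 oneOutsidePerSide-S₀ (twoOnEachSide-S₀ large) , ∣S₀∣) ,
    λ S resolving → m≤n+o⇒m∸n≤o (s + t) 2 (resolving⇒≤2+ 0 resolving)

  thMdim-small : ∀ {p} → sideSize p ≤ 2 → IsThMdim G (s + t)
  thMdim-small small = isThMdim G (mdim₀ G neighbour) refl bound
    where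
    bound : ∀ r S → IsMixedResolving G r S → s + t ≤ r + ∣ S ∣
    bound zero          S resolving = proj₂ (mdim₀ G neighbour) S resolving
    bound (suc zero)    S resolving = small-side⇒≤1+ 0 small resolving
    bound (suc (suc r)) S resolving =
      ≤-trans (resolving⇒≤2+ (suc r) resolving) (s≤s (s≤s (m≤n+m ∣ S ∣ r)))

  thMdim-large : (∀ p → 3 ≤ sideSize p) → IsThMdim G (s + t ∸ 1)
  thMdim-large large = isThMdim G (mdim₁-large large) (sym (+-∸-assoc 1 2≤s+t)) bound
    where
    2≤s+t : 2 ≤ s + t
    2≤s+t = s≤s (≤-trans (s≤s z≤n) (m≤n+m t s′))
    bound : ∀ r S → IsMixedResolving G r S → s + t ∸ 1 ≤ r + ∣ S ∣
    bound zero    S resolving = ≤-trans (m∸n≤m (s + t) 1) (proj₂ (mdim₀ G neighbour) S resolving)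
    bound (suc r) S resolving =
      ≤-trans (m≤n+o⇒m∸n≤o (s + t) 1 (resolving⇒≤2+ r resolving)) (s≤s (m≤n+m ∣ S ∣ r))

mainTheorem14 : (s t : ℕ) → 1 ≤ s → 1 ≤ t →
    ((s ⊓ t ≤ 2 → IsThMdim (K s t) (s + t))
     × (2 < s ⊓ t → IsThMdim (K s t) (s + t ∸ 1)))
mainTheorem14 (suc s′) (suc t′) _ _ = small , large
  where
  open CompleteBipartite s′ t′
  small : s ⊓ t ≤ 2 → IsThMdim G (s + t)
  small s⊓t≤2 with ⊓-sel s t
  ... | inj₁ s⊓t≡s = thMdim-small {true}  (subst (_≤ 2) s⊓t≡s s⊓t≤2)
  ... | inj₂ s⊓t≡t = thMdim-small {false} (subst (_≤ 2) s⊓t≡t s⊓t≤2)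
  large : 2 < s ⊓ t → IsThMdim G (s + t ∸ 1)
  large 2<s⊓t = thMdim-large λ
    { true  → ≤-trans 2<s⊓t (m⊓n≤m s t)
    ; false → ≤-trans 2<s⊓t (m⊓n≤n s t) }
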